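{- Let $G$ be a quasi-bipartite directed graph with root $r$ and terminals $T$, let $\hat G\subseteq G$ be rooted $\ell$-connected, and let $\mathcal{C}$ be the set of cores of $\hat G$. For any edge $e\in E(G)$, there is at most one core $C\in\mathcal{C}$ such that both endpoints of $e$ lie in the Halo-set $H(C)$.
   Context: $G$ is quasi-bipartite if no edge joins two non-terminal (Steiner) vertices, i.e., two vertices of $V\setminus(T\cup\{r\})$. $\hat G$ is rooted $\ell$-connected if it contains $\ell$ edge-disjoint $r\to t$ paths for each $t\in T\subseteq V\setminus\{r\}$. A deficient set is $U\subseteq V$ with $r\notin U$, $U\cap T\ne\emptyset$ and exactly $\ell$ edges of $\hat G$ entering $U$. A core is a deficient set properly containing no other deficient set; $\mathsf{Halo}(C)$ is the family of deficient sets containing core $C$ and no other core; $H(C)=\bigcup_{U\in\mathsf{Halo}(C)}U$. -}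

module Defs where

open import Data.Nat using (ℕ; zero; suc)
open import Data.Fin using (Fin)
open import Data.Bool using (Bool; true; false; not; _∧_)
open import Data.List using (List; []; _∷_; length; lookup; concat)
open import Data.List.Relation.Unary.Unique.Propositional using (Unique)
open import Data.List.Relation.Unary.All using (All)
open import Data.Vec using (Vec; toList)
open import Data.Product using (_×_; _,_; proj₁; proj₂; Σ; ∃; ∃-syntax)
open import Relation.Binary.PropositionalEquality using (_≡_; _≢_)
open import Relation.Nullary using (¬_)

-- A directed multigraph on vertex set Fin n is given by a list of edges
-- (tail , head); parallel edges are distinct list entries.
Edges : ℕ → Set
Edges n = List (Fin n × Fin n)

VSet : ℕ → Set
VSet n = Fin n → Bool

_∈ᵥ_ : ∀ {n} → Fin n → VSet n → Set
v ∈ᵥ U = U v ≡ true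

_⊆ᵥ_ : ∀ {n} → VSet n → VSet n → Set
U ⊆ᵥ W = ∀ v → v ∈ᵥ U → v ∈ᵥ W

_≐_ : ∀ {n} → VSet n → VSet n → Set
U ≐ W = ∀ v → U v ≡ W v

_⊂ᵥ_ : ∀ {n} → VSet n → VSet n → Set
U ⊂ᵥ W = U ⊆ᵥ W × ∃[ v ] (v ∈ᵥ W × ¬ (v ∈ᵥ U))

Steiner : ∀ {n} → Fin n → VSet n → Fin n → Set
Steiner r T v = (v ≢ r) × (T v ≡ false)

QuasiBipartite : ∀ {n} → Fin n → VSet n → Edges n → Set
QuasiBipartite r T E = All (λ e → ¬ (Steiner r T (proj₁ e) × Steiner r T (proj₂ e))) E

data IsWalk {n} (E : Edges n) : Fin n → Fin n → List (Fin (length E)) → Set where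
  nil  : ∀ {u} → IsWalk E u u []
  cons : ∀ {u v i is} → proj₁ (lookup E i) ≡ u →
         IsWalk E (proj₂ (lookup E i)) v is → IsWalk E u v (i ∷ is)

-- ℓ pairwise edge-disjoint walks (equivalently paths) from r to t.
EdgeDisjointPaths : ∀ {n} → Edges n → ℕ → Fin n → Fin n → Set
EdgeDisjointPaths E ℓ r t =
  Σ (Vec (List (Fin (length E))) ℓ) λ ps →
    All (IsWalk E r t) (toList ps) × Unique (concat (toList ps))

RootedConnected : ∀ {n} → Edges n → ℕ → Fin n → VSet n → Set
RootedConnected E ℓ r T = ∀ t → t ∈ᵥ T → EdgeDisjointPaths E ℓ r t

inDegree : ∀ {n} → Edges n → VSet n → ℕ
inDegree [] U = zero
inDegree ((a , b) ∷ E) U with not (U a) ∧ U b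
... | true  = suc (inDegree E U)
... | false = inDegree E U

Deficient : ∀ {n} → Edges n → ℕ → Fin n → VSet n → VSet n → Set
Deficient E ℓ r T U =
  ¬ (r ∈ᵥ U) × (∃[ t ] (t ∈ᵥ U × t ∈ᵥ T)) × inDegree E U ≡ ℓ

IsCore : ∀ {n} → Edges n → ℕ → Fin n → VSet n → VSet n → Set
IsCore E ℓ r T C =
  Deficient E ℓ r T C × (∀ U → Deficient E ℓ r T U → ¬ (U ⊂ᵥ C))

InHalo : ∀ {n} → Edges n → ℕ → Fin n → VSet n → VSet n → VSet n → Set
InHalo E ℓ r T C U =
  Deficient E ℓ r T U × C ⊆ᵥ U ×
  (∀ C' → IsCore E ℓ r T C' → C' ⊆ᵥ U → C' ≐ C)

InH : ∀ {n} → Edges n → ℕ → Fin n → VSet n → VSet n → Fin n → Set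
InH E ℓ r T C v = ∃[ U ] (InHalo E ℓ r T C U × v ∈ᵥ U)

-- One endpoint t of e is a terminal: e does not join two Steiner vertices,
-- and neither endpoint is the root, since halo sets avoid r.  If t lies in
-- U₁ ∈ Halo(C₁) and U₂ ∈ Halo(C₂), then U₁ ∩ U₂ and U₁ ∪ U₂ avoid r and
-- contain t, so by rooted ℓ-connectivity each has in-degree at least ℓ.
-- Submodularity of in-degree, d(U₁ ∩ U₂) + d(U₁ ∪ U₂) ≤ d(U₁) + d(U₂) = 2ℓ,
-- then makes U₁ ∩ U₂ deficient.  A core inside U₁ ∩ U₂ lies in both halo
-- sets, hence equals C₁ and C₂.  Constructively such a core exists only up
-- to double negation, which suffices since equality of Booleans is stable.
module Submission where

open import Defs
open import Data.Bool using (Bool; true; false; not; _∧_; _∨_)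
open import Data.Bool.Properties using (¬-not) renaming (_≟_ to _≟ᵇ_)
open import Data.Empty using (⊥-elim)
open import Data.Fin using (Fin; zero; suc)
open import Data.Fin.Subset using (_⊂_) renaming (_∈_ to _∈ₛ_)
open import Data.Fin.Subset.Induction using (⊂-wellFounded)
open import Data.List using (List; []; _∷_; length; lookup; concat)
open import Data.List.Membership.Propositional using (_∈_)
open import Data.List.Relation.Unary.All using (All; []; _∷_)
import Data.List.Relation.Unary.All as All
open import Data.List.Relation.Unary.Any using (here; there)
open import Data.List.Relation.Unary.Unique.Propositional using (Unique; []; _∷_)
open import Data.List.Relation.Binary.Sublist.Propositional
  using (_⊆_; []; _∷_; _∷ʳ_; from∈)
open import Data.List.Relation.Binary.Sublist.Propositional.Properties
  using (All-resp-⊆; ++⁺)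
open import Data.Nat using (ℕ; suc; _+_; _≤_; z≤n; s≤s)
open import Data.Nat.Properties
  using ( ≤-refl; ≤-trans; ≤-reflexive; ≤-antisym; +-mono-≤; +-monoʳ-≤; +-cancelʳ-≤
        ; +-commutativeSemigroup; module ≤-Reasoning)
open import Algebra.Properties.CommutativeSemigroup +-commutativeSemigroup using (interchange)
open import Data.Product using (_×_; _,_; proj₁; proj₂; ∃-syntax)
open import Data.Sum using (_⊎_; inj₁; inj₂)
open import Data.Vec using (tabulate; toList)
open import Data.Vec.Properties using (lookup∘tabulate; lookup⇒[]=; []=⇒lookup; length-toList)
open import Function using (_∘_)
open import Induction.WellFounded using (WellFounded; Acc; acc; module Subrelation)
import Relation.Binary.Construct.On as On
open import Relation.Binary.PropositionalEquality using (_≡_; _≢_; refl; sym; trans; cong; cong₂; subst)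
open import Relation.Nullary using (¬_; contradiction)
open import Relation.Nullary.Decidable using (decidable-stable)

private
  variable
    n : ℕ

∧-true : ∀ {x y} → x ≡ true → y ≡ true → x ∧ y ≡ true
∧-true refl refl = refl

∧-trueˡ : ∀ {x y} → x ∧ y ≡ true → x ≡ true
∧-trueˡ {true} _ = refl

∧-trueʳ : ∀ {x y} → x ∧ y ≡ true → y ≡ true
∧-trueʳ {true} y≡true = y≡true

not-∧-true : ∀ {x y} → x ≡ false → y ≡ true → not x ∧ y ≡ true
not-∧-true refl refl = refl

∨-trueˡ : ∀ {x y} → x ≡ true → x ∨ y ≡ true
∨-trueˡ refl = refl

∨-≢true : ∀ {x y} → x ≢ true → y ≢ true → x ∨ y ≢ true
∨-≢true {true} x≢true _ = x≢true
∨-≢true {false} _ y≢true = y≢true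

_∩ᵥ_ _∪ᵥ_ : VSet n → VSet n → VSet n
(U ∩ᵥ W) v = U v ∧ W v
(U ∪ᵥ W) v = U v ∨ W v

⊆ᵥ-refl : {U : VSet n} → U ⊆ᵥ U
⊆ᵥ-refl _ v∈U = v∈U

⊆ᵥ-trans : {U V W : VSet n} → U ⊆ᵥ V → V ⊆ᵥ W → U ⊆ᵥ W
⊆ᵥ-trans U⊆V V⊆W v = V⊆W v ∘ U⊆V v

∈ᵥ⇒∈ₛ : ∀ {v} {U : VSet n} → v ∈ᵥ U → v ∈ₛ tabulate U
∈ᵥ⇒∈ₛ {v = v} {U} v∈U = lookup⇒[]= v (tabulate U) (trans (lookup∘tabulate U v) v∈U)

∈ₛ⇒∈ᵥ : ∀ {v} {U : VSet n} → v ∈ₛ tabulate U → v ∈ᵥ U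
∈ₛ⇒∈ᵥ {v = v} {U} v∈U = trans (sym (lookup∘tabulate U v)) ([]=⇒lookup v∈U)

⊂ᵥ⇒⊂ : {U W : VSet n} → U ⊂ᵥ W → tabulate U ⊂ tabulate W
⊂ᵥ⇒⊂ (U⊆W , v , v∈W , v∉U) =
  (λ {x} → ∈ᵥ⇒∈ₛ ∘ U⊆W x ∘ ∈ₛ⇒∈ᵥ) , v , ∈ᵥ⇒∈ₛ v∈W , v∉U ∘ ∈ₛ⇒∈ᵥ

⊂ᵥ-wellFounded : WellFounded (_⊂ᵥ_ {n})
⊂ᵥ-wellFounded = Subrelation.wellFounded ⊂ᵥ⇒⊂ (On.wellFounded tabulate ⊂-wellFounded)

Enters : VSet n → Fin n × Fin n → Set
Enters U (a , b) = not (U a) ∧ U b ≡ true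

walk-enters : ∀ (U : VSet n) {E u v is} → IsWalk E u v is → U u ≡ false → U v ≡ true →
              ∃[ i ] (i ∈ is × Enters U (lookup E i))
walk-enters U nil u∉U v∈U = contradiction (trans (sym u∉U) v∈U) λ ()
walk-enters U {E} (cons {i = i} refl walk) u∉U v∈U with U (proj₂ (lookup E i)) in head∈U
... | true  = i , here refl , not-∧-true u∉U head∈U
... | false with walk-enters U walk head∈U v∈U
...   | j , j∈is , enters = j , there j∈is , enters

enteringEdges : ∀ (U : VSet n) {E : Edges n} {r t} → U r ≡ false → U t ≡ true →
                (walks : List (List (Fin (length E)))) → All (IsWalk E r t) walks →
                ∃[ is ] (length is ≡ length walks × is ⊆ concat walks × All (Enters U ∘ lookup E) is)
enteringEdges U r∉U t∈U [] [] = [] , refl , [] , []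
enteringEdges U r∉U t∈U (w ∷ ws) (walk ∷ walks)
  with walk-enters U walk r∉U t∈U | enteringEdges U r∉U t∈U ws walks
... | i , i∈w , enters | is , len , is⊆ws , allEnter =
  i ∷ is , cong suc len , ++⁺ (from∈ i∈w) is⊆ws , enters ∷ allEnter

Unique-resp-⊆ : ∀ {A : Set} {xs ys : List A} → xs ⊆ ys → Unique ys → Unique xs
Unique-resp-⊆ []         []             = []
Unique-resp-⊆ (_ ∷ʳ xs⊆) (_ ∷ unique)   = Unique-resp-⊆ xs⊆ unique
Unique-resp-⊆ (refl ∷ xs⊆) (y∉ ∷ unique) = All-resp-⊆ xs⊆ y∉ ∷ Unique-resp-⊆ xs⊆ unique

tailIndices : List (Fin (suc n)) → List (Fin n)
tailIndices []           = []
tailIndices (zero ∷ is)  = tailIndices is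
tailIndices (suc i ∷ is) = i ∷ tailIndices is

All-tailIndices : ∀ {P : Fin (suc n) → Set} {is} → All P is → All (P ∘ suc) (tailIndices is)
All-tailIndices {is = []}          []       = []
All-tailIndices {is = zero ∷ _}    (_ ∷ ps) = All-tailIndices ps
All-tailIndices {is = suc _ ∷ _}   (p ∷ ps) = p ∷ All-tailIndices ps

Unique-tailIndices : {is : List (Fin (suc n))} → Unique is → Unique (tailIndices is)
Unique-tailIndices {is = []}        []             = []
Unique-tailIndices {is = zero ∷ _}  (_ ∷ unique)   = Unique-tailIndices unique
Unique-tailIndices {is = suc _ ∷ _} (i∉ ∷ unique) =
  All.map (λ i≢j → i≢j ∘ cong suc) (All-tailIndices i∉) ∷ Unique-tailIndices unique

length-tailIndices-∌zero : {is : List (Fin (suc n))} → All (zero ≢_) is →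
                           length is ≤ length (tailIndices is)
length-tailIndices-∌zero {is = []}        []       = z≤n
length-tailIndices-∌zero {is = zero ∷ _}  (z∉ ∷ _) = contradiction refl z∉
length-tailIndices-∌zero {is = suc _ ∷ _} (_ ∷ ps) = s≤s (length-tailIndices-∌zero ps)

length-tailIndices : {is : List (Fin (suc n))} → Unique is →
                     length is ≤ suc (length (tailIndices is))
length-tailIndices {is = []}        []             = z≤n
length-tailIndices {is = zero ∷ _}  (z∉ ∷ _)       = s≤s (length-tailIndices-∌zero z∉)
length-tailIndices {is = suc _ ∷ _} (_ ∷ unique)   = s≤s (length-tailIndices unique)

length≤inDegree : ∀ (U : VSet n) (E : Edges n) {is} → Unique is →
                  All (Enters U ∘ lookup E) is → length is ≤ inDegree E U
length≤inDegree U [] {[]} _ _ = z≤n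
length≤inDegree U ((a , b) ∷ E) unique allEnter with not (U a) ∧ U b in head
... | true  = ≤-trans (length-tailIndices unique)
                (s≤s (length≤inDegree U E (Unique-tailIndices unique) (All-tailIndices allEnter)))
... | false = ≤-trans (length-tailIndices-∌zero (All.map headNotEntering allEnter))
                (length≤inDegree U E (Unique-tailIndices unique) (All-tailIndices allEnter))
  where
  headNotEntering : ∀ {i} → Enters U (lookup ((a , b) ∷ E) i) → zero ≢ i
  headNotEntering enters refl = contradiction (trans (sym enters) head) λ ()

-- Menger's easy direction: each of the ℓ edge-disjoint r → t paths enters U.
rootedConnected⇒ℓ≤inDegree : ∀ {E : Edges n} {ℓ r T U t} → RootedConnected E ℓ r T →
                             ¬ (r ∈ᵥ U) → t ∈ᵥ U → t ∈ᵥ T → ℓ ≤ inDegree E U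
rootedConnected⇒ℓ≤inDegree {E = E} {U = U} {t} connected r∉U t∈U t∈T
  with connected t t∈T
... | paths , arePaths , disjoint with enteringEdges U (¬-not r∉U) t∈U (toList paths) arePaths
...   | is , len , is⊆paths , allEnter =
  subst (_≤ inDegree E U) (trans len (length-toList paths))
    (length≤inDegree U E (Unique-resp-⊆ is⊆paths disjoint) allEnter)

enterIndicator : Bool → Bool → ℕ
enterIndicator false true = 1
enterIndicator _     _    = 0

inDegree-∷ : ∀ (U : VSet n) a b E →
             inDegree ((a , b) ∷ E) U ≡ enterIndicator (U a) (U b) + inDegree E U
inDegree-∷ U a b E with U a | U b
... | true  | _     = refl
... | false | true  = refl
... | false | false = refl

enterIndicator-submodular : ∀ x y x′ y′ →
  enterIndicator (x ∧ x′) (y ∧ y′) + enterIndicator (x ∨ x′) (y ∨ y′)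
    ≤ enterIndicator x y + enterIndicator x′ y′
enterIndicator-submodular true  _     true  _     = z≤n
enterIndicator-submodular true  false false _     = z≤n
enterIndicator-submodular true  true  false false = z≤n
enterIndicator-submodular true  true  false true  = ≤-refl
enterIndicator-submodular false false true  _     = z≤n
enterIndicator-submodular false true  true  false = z≤n
enterIndicator-submodular false true  true  true  = ≤-refl
enterIndicator-submodular false false false y′    = ≤-refl
enterIndicator-submodular false true  false false = ≤-refl
enterIndicator-submodular false true  false true  = ≤-refl

inDegree-submodular : ∀ (E : Edges n) (U W : VSet n) →
  inDegree E (U ∩ᵥ W) + inDegree E (U ∪ᵥ W) ≤ inDegree E U + inDegree E W
inDegree-submodular [] U W = z≤n
inDegree-submodular ((a , b) ∷ E) U W = begin
    inDegree ((a , b) ∷ E) (U ∩ᵥ W) + inDegree ((a , b) ∷ E) (U ∪ᵥ W)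
  ≡⟨ cong₂ _+_ (inDegree-∷ (U ∩ᵥ W) a b E) (inDegree-∷ (U ∪ᵥ W) a b E) ⟩
    (e∩ + inDegree E (U ∩ᵥ W)) + (e∪ + inDegree E (U ∪ᵥ W))
  ≡⟨ interchange e∩ _ e∪ _ ⟩
    (e∩ + e∪) + (inDegree E (U ∩ᵥ W) + inDegree E (U ∪ᵥ W))
  ≤⟨ +-mono-≤ (enterIndicator-submodular (U a) (U b) (W a) (W b)) (inDegree-submodular E U W) ⟩
    (eU + eW) + (inDegree E U + inDegree E W)
  ≡⟨ interchange eU eW _ _ ⟩
    (eU + inDegree E U) + (eW + inDegree E W)
  ≡⟨ sym (cong₂ _+_ (inDegree-∷ U a b E) (inDegree-∷ W a b E)) ⟩
    inDegree ((a , b) ∷ E) U + inDegree ((a , b) ∷ E) W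
  ∎
  where
  open ≤-Reasoning
  e∩ e∪ eU eW : ℕ
  e∩ = enterIndicator (U a ∧ W a) (U b ∧ W b)
  e∪ = enterIndicator (U a ∨ W a) (U b ∨ W b)
  eU = enterIndicator (U a) (U b)
  eW = enterIndicator (W a) (W b)

m+n≤o+o⇒m≡o : ∀ {m n o} → m + n ≤ o + o → o ≤ m → o ≤ n → m ≡ o
m+n≤o+o⇒m≡o {m} {n} {o} m+n≤o+o o≤m o≤n =
  ≤-antisym (+-cancelʳ-≤ o m o (≤-trans (+-monoʳ-≤ m o≤n) m+n≤o+o)) o≤m

module _ (E : Edges n) (ℓ : ℕ) (r : Fin n) (T : VSet n) where

  deficient⇒¬¬core⊆ : ∀ D → Deficient E ℓ r T D → ¬ ¬ (∃[ C ] (IsCore E ℓ r T C × C ⊆ᵥ D))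
  deficient⇒¬¬core⊆ D = go D (⊂ᵥ-wellFounded D)
    where
    -- Were there no core inside D, every deficient U ⊂ D would (by induction)
    -- contradict that, so D itself would be a core.
    go : ∀ D → Acc _⊂ᵥ_ D → Deficient E ℓ r T D → ¬ ¬ (∃[ C ] (IsCore E ℓ r T C × C ⊆ᵥ D))
    go D (acc below) deficientD noCore = noCore (D , (deficientD , minimal) , ⊆ᵥ-refl)
      where
      minimal : ∀ U → Deficient E ℓ r T U → ¬ (U ⊂ᵥ D)
      minimal U deficientU U⊂D = go U (below U⊂D) deficientU
        λ (C , isCore , C⊆U) → noCore (C , isCore , ⊆ᵥ-trans C⊆U (proj₁ U⊂D))

  deficient-∩ : RootedConnected E ℓ r T → ∀ {U W t} →
                Deficient E ℓ r T U → Deficient E ℓ r T W →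
                t ∈ᵥ U → t ∈ᵥ W → t ∈ᵥ T → Deficient E ℓ r T (U ∩ᵥ W)
  deficient-∩ connected {U} {W} (r∉U , _ , dU) (r∉W , _ , dW) t∈U t∈W t∈T =
    r∉U ∘ ∧-trueˡ , (_ , ∧-true t∈U t∈W , t∈T) ,
    m+n≤o+o⇒m≡o
      (≤-trans (inDegree-submodular E U W) (≤-reflexive (cong₂ _+_ dU dW)))
      (rootedConnected⇒ℓ≤inDegree connected (r∉U ∘ ∧-trueˡ) (∧-true t∈U t∈W) t∈T)
      (rootedConnected⇒ℓ≤inDegree connected (∨-≢true r∉U r∉W) (∨-trueˡ t∈U) t∈T)

  halos-sharing-terminal⇒≐ : RootedConnected E ℓ r T → ∀ {C₁ C₂ U₁ U₂ t} →
    InHalo E ℓ r T C₁ U₁ → InHalo E ℓ r T C₂ U₂ →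
    t ∈ᵥ U₁ → t ∈ᵥ U₂ → t ∈ᵥ T → C₁ ≐ C₂
  halos-sharing-terminal⇒≐ connected {C₁} {C₂}
    (deficient₁ , _ , onlyC₁) (deficient₂ , _ , onlyC₂) t∈U₁ t∈U₂ t∈T v =
    decidable-stable (C₁ v ≟ᵇ C₂ v) λ C₁v≢C₂v →
      deficient⇒¬¬core⊆ _ (deficient-∩ connected deficient₁ deficient₂ t∈U₁ t∈U₂ t∈T)
        λ (C , isCore , C⊆U₁∩U₂) → C₁v≢C₂v (trans
          (sym (onlyC₁ C isCore (λ w → ∧-trueˡ ∘ C⊆U₁∩U₂ w) v))
          (onlyC₂ C isCore (λ w → ∧-trueʳ ∘ C⊆U₁∩U₂ w) v))

  ∈deficient⇒≢root : ∀ {U v} → Deficient E ℓ r T U → v ∈ᵥ U → v ≢ r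
  ∈deficient⇒≢root (r∉U , _) v∈U refl = r∉U v∈U

quasiBipartite⇒terminal-endpoint : ∀ {r : Fin n} {T EG a b} → QuasiBipartite r T EG →
  (a , b) ∈ EG → a ≢ r → b ≢ r → a ∈ᵥ T ⊎ b ∈ᵥ T
quasiBipartite⇒terminal-endpoint {T = T} {a = a} {b} quasiBipartite ab∈EG a≢r b≢r
  with T a in a∈T | T b in b∈T
... | true  | _     = inj₁ refl
... | false | true  = inj₂ refl
... | false | false = ⊥-elim (All.lookup quasiBipartite ab∈EG ((a≢r , a∈T) , (b≢r , b∈T)))

lemma15 : ∀ {n} (r : Fin n) (T : VSet n) (ℓ : ℕ) (EG EĜ : Edges n) →
    T r ≡ false →
    QuasiBipartite r T EG →
    EĜ ⊆ EG →
    RootedConnected EĜ ℓ r T →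
    ∀ e → e ∈ EG →
    ∀ C₁ C₂ → IsCore EĜ ℓ r T C₁ → IsCore EĜ ℓ r T C₂ →
    InH EĜ ℓ r T C₁ (proj₁ e) → InH EĜ ℓ r T C₁ (proj₂ e) →
    InH EĜ ℓ r T C₂ (proj₁ e) → InH EĜ ℓ r T C₂ (proj₂ e) →
    C₁ ≐ C₂
lemma15 r T ℓ EG EĜ _ quasiBipartite _ connected (a , b) e∈EG _ _ _ _
  (_ , halo₁ , a∈U₁) (_ , halo₁′ , b∈W₁) (_ , halo₂ , a∈U₂) (_ , halo₂′ , b∈W₂)
  with quasiBipartite⇒terminal-endpoint quasiBipartite e∈EG
         (∈deficient⇒≢root EĜ ℓ r T (proj₁ halo₁) a∈U₁)
         (∈deficient⇒≢root EĜ ℓ r T (proj₁ halo₁′) b∈W₁)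
... | inj₁ a∈T = halos-sharing-terminal⇒≐ EĜ ℓ r T connected halo₁ halo₂ a∈U₁ a∈U₂ a∈T
... | inj₂ b∈T = halos-sharing-terminal⇒≐ EĜ ℓ r T connected halo₁′ halo₂′ b∈W₁ b∈W₂ b∈T
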